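{- Let $\sigma$ be a cyclic permutation of $\{1,\dots,n\}$ and $k>1$ an integer. Then the permutation $A(\sigma,k)$ of $\{1,\dots,n+k\}$ is cyclic, and $\Gamma(P(A(\sigma,k)))=\Gamma(P(\sigma))+(1^k)$.
   Context: Permutations are written as sequences $(\sigma_1,\dots,\sigma_n)$ with $\sigma_i$ the image of $i$; a permutation is cyclic if its cycle decomposition is a single cycle of full length. For $N\ge1$, $L(N)$ is the decreasing sequence of the elements of $\{1,\dots,N\}\setminus\{\lceil N/2\rceil\}$. $I(\tau)$ adds $1$ to every entry of $\tau$, $I^k$ is its $k$-fold iterate, $\oplus$ is concatenation. $A(\sigma,k)$ is obtained from $\sigma$ by replacing the entry $n$ by $n+\lceil k/2\rceil$ and then appending $I^n(L(k))\oplus(n)$. $P(\tau)$ is the Robinson--Schensted--Knuth insertion tableau (Schensted row insertion of the entries in order) and $\Gamma(P(\tau))$ its shape (row lengths, nonincreasing). For sequences $\gamma^1,\gamma^2$, $\gamma^1+\gamma^2$ is the entrywise sum with missing entries taken as $0$; $(1^k)$ is the sequence of $k$ ones. -}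

module Defs where

open import Data.Nat using (ℕ; zero; suc; _+_; _≤_; _<ᵇ_; _≟_; ⌈_/2⌉)
open import Data.Nat.Properties using ()
open import Data.Bool using (Bool; true; false; if_then_else_)
open import Data.List using (List; []; _∷_; _++_; map; length; upTo; downFrom; filter; replicate)
open import Data.List.Relation.Binary.Permutation.Propositional using (_↭_)
open import Data.Maybe using (Maybe; just; nothing)
open import Data.Product using (_×_; _,_; ∃)
open import Function using (_∘_)
open import Relation.Nullary using (¬?)
open import Relation.Nullary.Decidable using (⌊_⌋)
open import Relation.Binary.PropositionalEquality using (_≡_)

-- A permutation of {1..n} in one-line notation: the list (σ₁,…,σₙ).
-- The ascending list [1, …, n]:
oneTo : ℕ → List ℕ
oneTo n = map suc (upTo n)

IsPerm : ℕ → List ℕ → Set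
IsPerm n σ = σ ↭ oneTo n

-- σ(i) for a sequence: the i-th entry (1-based); 0 outside range.
apply : List ℕ → ℕ → ℕ
apply [] _ = 0
apply (x ∷ xs) zero = 0
apply (x ∷ xs) (suc zero) = x
apply (x ∷ xs) (suc (suc i)) = apply xs (suc i)

iter : (ℕ → ℕ) → ℕ → ℕ → ℕ
iter f zero x = x
iter f (suc i) x = f (iter f i x)

-- Cyclic: the cycle decomposition is a single cycle of full length,
-- i.e. every element of {1..n} lies in the orbit (cycle) of 1.
IsCyclic : ℕ → List ℕ → Set
IsCyclic n σ = ∀ j → 1 ≤ j → j ≤ n → ∃ λ i → iter (apply σ) i 1 ≡ j

L : ℕ → List ℕ
L N = filter (λ x → ¬? (x ≟ ⌈ N /2⌉)) (map suc (downFrom N))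

Iter-I : ℕ → List ℕ → List ℕ
Iter-I k τ = map (k +_) τ

A : ℕ → List ℕ → ℕ → List ℕ
A n σ k =
  map (λ x → if ⌊ x ≟ n ⌋ then n + ⌈ k /2⌉ else x) σ
  ++ (Iter-I n (L k) ++ (n ∷ []))

Tableau : Set
Tableau = List (List ℕ)

bump : ℕ → List ℕ → Maybe ℕ × List ℕ
bump x [] = nothing , (x ∷ [])
bump x (y ∷ ys) with x <ᵇ y
... | true  = just y , (x ∷ ys)
... | false with bump x ys
...   | (m , ys') = m , (y ∷ ys')

rowInsert : ℕ → Tableau → Tableau
rowInsert x [] = (x ∷ []) ∷ []
rowInsert x (r ∷ rs) with bump x r
... | (nothing , r') = r' ∷ rs
... | (just y , r') = r' ∷ rowInsert y rs

insertAll : Tableau → List ℕ → Tableau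
insertAll T [] = T
insertAll T (x ∷ xs) = insertAll (rowInsert x T) xs

P : List ℕ → Tableau
P τ = insertAll [] τ

Γ : Tableau → List ℕ
Γ T = map length T

_⊞_ : List ℕ → List ℕ → List ℕ
[] ⊞ ys = ys
(x ∷ xs) ⊞ [] = x ∷ xs
(x ∷ xs) ⊞ (y ∷ ys) = (x + y) ∷ (xs ⊞ ys)

ones : ℕ → List ℕ
ones k = replicate k 1

-- Write σ = α ⊕ (n) ⊕ β.  With c = ⌈k/2⌉ and j = ⌊k/2⌋, A(σ,k) = α ⊕ (n+c) ⊕ β ⊕ τ, where
-- τ = (n+k, …, n+c+1, n+c−1, …, n) consists of two decreasing runs.
--
-- The letter n + c is the largest of α ⊕ (n+c) ⊕ β, and any other value above the letters of α
-- and β would give the same insertion tableau up to that value: a tableau S of the letters below n with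
-- the largest letter appended to a row r.  In particular P(σ) is S with n appended to row r.  The
-- letters of τ are at least n, so they never disturb S and only meet the box n + c.  They form a column
-- of length k beside it; if c > r the lower run pushes n + c into that column and n + c + 1 takes its
-- place at the end of row r.  Either way the shape grows by exactly (1^k).
--
-- A(σ,k) sends n+1, …, n+k to n+k, …, n+c+1, n+c−1, …, n, so from n + c the orbit zigzags
-- through all of n+1, …, n+k and ends at n.  The cycle of σ, rerouted through n + c at its step into n,
-- therefore becomes a single cycle through 1, …, n + k.

module Submission where

open import Defs
open import Data.Bool using (true; false; T; if_then_else_)
open import Data.Maybe using (just; nothing)
open import Data.Maybe.Relation.Unary.All as Maybe using (just; nothing)
open import Data.Nat using (ℕ; zero; suc; _+_; _≤_; _<_; _<ᵇ_; z≤n; s≤s; _≟_; ⌈_/2⌉; ⌊_/2⌋; _≤?_)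
open import Data.Nat.Properties
open import Data.Nat.Tactic.RingSolver using (solve-∀)
open import Data.List using (List; []; _∷_; [_]; _++_; map; length; filter; upTo; downFrom)
open import Data.List.Properties
  using (++-assoc; ++-identityʳ; length-++; length-map; length-upTo; map-++; filter-++; filter-all; filter-reject; upTo-∷ʳ)
open import Data.List.Membership.Propositional using (_∈_)
open import Data.List.Membership.Propositional.Properties using (∈-map⁺; ∈-map⁻; ∈-upTo⁺; ∈-upTo⁻; ∈-∃++)
open import Data.List.Relation.Unary.All as All using (All; []; _∷_)
open import Data.List.Relation.Unary.All.Properties as All using (++⁺)
open import Data.List.Relation.Unary.Any using (here; there)
open import Data.List.Relation.Unary.Linked using (Linked; []; [-]; _∷_) renaming (tail to Linked-tail)
open import Data.List.Relation.Binary.Permutation.Propositional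
  using (_↭_; ↭-sym; ↭-reflexive; module PermutationReasoning)
open import Data.List.Relation.Binary.Permutation.Propositional.Properties as ↭
  using (++⁺ʳ; ++⁺ˡ; shift; drop-mid; Any-resp-↭; All-resp-↭)
open import Data.Product using (_×_; _,_; ∃; ∃₂; proj₁; proj₂; map₂)
open import Data.Sum as Sum using (_⊎_; inj₁; inj₂)
open import Data.Unit using (⊤; tt)
open import Relation.Nullary using (yes; no; ¬?; contradiction)
open import Relation.Nullary.Decidable using (⌊_⌋)
open import Relation.Binary.PropositionalEquality
  using (_≡_; _≢_; refl; sym; trans; cong; cong₂; subst; module ≡-Reasoning)

<⇒<ᵇ≡true : ∀ {x y} → x < y → (x <ᵇ y) ≡ true
<⇒<ᵇ≡true {zero}  {suc y} _         = refl
<⇒<ᵇ≡true {suc x} {suc y} (s≤s x<y) = <⇒<ᵇ≡true x<y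

≥⇒<ᵇ≡false : ∀ {x y} → y ≤ x → (x <ᵇ y) ≡ false
≥⇒<ᵇ≡false {x}     {zero}  _         = refl
≥⇒<ᵇ≡false {suc x} {suc y} (s≤s y≤x) = ≥⇒<ᵇ≡false y≤x

⌈n/2⌉≡⌊n/2⌋⊎1+⌊n/2⌋ : ∀ k → ⌈ k /2⌉ ≡ ⌊ k /2⌋ ⊎ ⌈ k /2⌉ ≡ suc ⌊ k /2⌋
⌈n/2⌉≡⌊n/2⌋⊎1+⌊n/2⌋ zero          = inj₁ refl
⌈n/2⌉≡⌊n/2⌋⊎1+⌊n/2⌋ (suc zero)    = inj₂ refl
⌈n/2⌉≡⌊n/2⌋⊎1+⌊n/2⌋ (suc (suc k)) = Sum.map (cong suc) (cong suc) (⌈n/2⌉≡⌊n/2⌋⊎1+⌊n/2⌋ k)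

ascending : ℕ → ℕ → List ℕ
ascending a zero    = []
ascending a (suc m) = a ∷ ascending (suc a) m

descending : ℕ → ℕ → List ℕ
descending a zero    = []
descending a (suc m) = a + m ∷ descending a m

length-ascending : ∀ a m → length (ascending a m) ≡ m
length-ascending a zero    = refl
length-ascending a (suc m) = cong suc (length-ascending (suc a) m)

length-descending : ∀ a m → length (descending a m) ≡ m
length-descending a zero    = refl
length-descending a (suc m) = cong suc (length-descending a m)

ascending-∷ʳ : ∀ a m → ascending a (suc m) ≡ ascending a m ++ [ a + m ]
ascending-∷ʳ a zero    = cong [_] (sym (+-identityʳ a))
ascending-∷ʳ a (suc m) =
  cong (a ∷_) (trans (ascending-∷ʳ (suc a) m) (cong (λ t → ascending (suc a) m ++ [ t ]) (sym (+-suc a m))))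

ascending-∷ʳ-++ : ∀ a m V → ascending a (suc m) ++ V ≡ ascending a m ++ a + m ∷ V
ascending-∷ʳ-++ a m V = trans (cong (_++ V) (ascending-∷ʳ a m)) (++-assoc (ascending a m) [ a + m ] V)

ascending-+ : ∀ a m m′ → ascending a (m + m′) ≡ ascending a m ++ ascending (a + m) m′
ascending-+ a zero    m′ = cong (λ b → ascending b m′) (sym (+-identityʳ a))
ascending-+ a (suc m) m′ =
  cong (a ∷_) (trans (ascending-+ (suc a) m m′) (cong (λ b → ascending (suc a) m ++ ascending b m′) (sym (+-suc a m))))

descending-+ : ∀ a m m′ → descending a (m + m′) ≡ descending (a + m′) m ++ descending a m′
descending-+ a zero    m′ = refl
descending-+ a (suc m) m′ = cong₂ _∷_ (trans (cong (a +_) (+-comm m m′)) (sym (+-assoc a m′ m))) (descending-+ a m m′)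

map-descending : ∀ n a m → map (n +_) (descending a m) ≡ descending (n + a) m
map-descending n a zero    = refl
map-descending n a (suc m) = cong₂ _∷_ (sym (+-assoc n a m)) (map-descending n a m)

ascending-> : ∀ {b a} m → b < a → All (b <_) (ascending a m)
ascending-> zero    b<a = []
ascending-> (suc m) b<a = b<a ∷ ascending-> m (m<n⇒m<1+n b<a)

descending-≥ : ∀ {b a} m → b ≤ a → All (b ≤_) (descending a m)
descending-≥ {a = a} zero    b≤a = []
descending-≥ {a = a} (suc m) b≤a = ≤-trans b≤a (m≤m+n a m) ∷ descending-≥ m b≤a

descending-< : ∀ {b} a m → a + m ≤ b → All (_< b) (descending a m)
descending-< a zero    _   = []
descending-< a (suc m) a+m<b =
  ≤-trans (≤-reflexive (sym (+-suc a m))) a+m<b ∷ descending-< a m (≤-trans (+-monoʳ-≤ a (n≤1+n m)) a+m<b)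

Increasing : List ℕ → Set
Increasing = Linked _<_

∷-ascending-increasing : ∀ {b} a m → b < a → Increasing (b ∷ ascending a m)
∷-ascending-increasing a zero    _   = [-]
∷-ascending-increasing a (suc m) b<a = b<a ∷ ∷-ascending-increasing (suc a) m (n<1+n a)

ascending-increasing : ∀ a m → Increasing (ascending a m)
ascending-increasing a zero    = []
ascending-increasing a (suc m) = ∷-ascending-increasing (suc a) m (n<1+n a)

ascending-++-increasing : ∀ a m {y ys} → a + m ≤ y → Increasing (y ∷ ys) → Increasing (ascending a m ++ y ∷ ys)
ascending-++-increasing a zero          _   inc = inc
ascending-++-increasing a (suc zero)    {y} a+1≤y inc = subst (_≤ y) (+-comm a 1) a+1≤y ∷ inc
ascending-++-increasing a (suc (suc m)) {y} a+m≤y inc =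
  n<1+n a ∷ ascending-++-increasing (suc a) (suc m) (subst (_≤ y) (+-suc a (suc m)) a+m≤y) inc

ascending-++-ascending-increasing : ∀ a m {b} j → a + m ≤ b → Increasing (ascending a m ++ ascending b j)
ascending-++-ascending-increasing a m zero    _     = subst Increasing (sym (++-identityʳ _)) (ascending-increasing a m)
ascending-++-ascending-increasing a m (suc j) a+m≤b = ascending-++-increasing a m a+m≤b (ascending-increasing _ (suc j))

Increasing-++⁻ʳ : ∀ xs {ys} → Increasing (xs ++ ys) → Increasing ys
Increasing-++⁻ʳ []       inc = inc
Increasing-++⁻ʳ (x ∷ xs) inc = Increasing-++⁻ʳ xs (Linked-tail inc)

-- Tableaux side by side and row insertion

infixr 5 _∥_
_∥_ : Tableau → Tableau → Tableau
[]      ∥ L       = L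
(s ∷ S) ∥ []      = s ∷ S
(s ∷ S) ∥ (l ∷ L) = (s ++ l) ∷ (S ∥ L)

∥-identityʳ : ∀ S → S ∥ [] ≡ S
∥-identityʳ []      = refl
∥-identityʳ (s ∷ S) = refl

single : ℕ → ℕ → Tableau
single zero    M = [ [ M ] ]
single (suc r) M = [] ∷ single r M

column : List ℕ → Tableau
column = map [_]

⊞-assoc : ∀ xs ys zs → (xs ⊞ ys) ⊞ zs ≡ xs ⊞ (ys ⊞ zs)
⊞-assoc []       ys       zs       = refl
⊞-assoc (x ∷ xs) []       zs       = refl
⊞-assoc (x ∷ xs) (y ∷ ys) []       = refl
⊞-assoc (x ∷ xs) (y ∷ ys) (z ∷ zs) = cong₂ _∷_ (+-assoc x y z) (⊞-assoc xs ys zs)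

⊞-comm : ∀ xs ys → xs ⊞ ys ≡ ys ⊞ xs
⊞-comm []       []       = refl
⊞-comm []       (y ∷ ys) = refl
⊞-comm (x ∷ xs) []       = refl
⊞-comm (x ∷ xs) (y ∷ ys) = cong₂ _∷_ (+-comm x y) (⊞-comm xs ys)

Γ-∥ : ∀ S L → Γ (S ∥ L) ≡ Γ S ⊞ Γ L
Γ-∥ []      L       = refl
Γ-∥ (s ∷ S) []      = refl
Γ-∥ (s ∷ S) (l ∷ L) = cong₂ _∷_ (length-++ s) (Γ-∥ S L)

Γ-column : ∀ V → Γ (column V) ≡ ones (length V)
Γ-column []      = refl
Γ-column (x ∷ V) = cong (1 ∷_) (Γ-column V)

Γ-single : ∀ r a b → Γ (single r a) ≡ Γ (single r b)
Γ-single zero    a b = refl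
Γ-single (suc r) a b = cong (0 ∷_) (Γ-single r a b)

AllT : (ℕ → Set) → Tableau → Set
AllT P = All (All P)

AllT-map : ∀ {P Q : ℕ → Set} → (∀ {a} → P a → Q a) → ∀ {T} → AllT P T → AllT Q T
AllT-map f = All.map (All.map f)

bump-all : ∀ x s → All (_< x) s → bump x s ≡ (nothing , s ++ [ x ])
bump-all x []      []           = refl
bump-all x (y ∷ s) (y<x ∷ s<x) rewrite ≥⇒<ᵇ≡false (<⇒≤ y<x) | bump-all x s s<x = refl

bump-++-nothing : ∀ x s t {s′} → bump x s ≡ (nothing , s′) → bump x (s ++ t) ≡ map₂ (s ++_) (bump x t)
bump-++-nothing x []      t _ = refl
bump-++-nothing x (y ∷ s) t eq with x <ᵇ y
bump-++-nothing x (y ∷ s) t () | true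
... | false with bump x s in e
... | nothing , _ rewrite bump-++-nothing x s t e = refl
bump-++-nothing x (y ∷ s) t () | false | just _ , _

bump-++-just : ∀ x s t {y s′} → bump x s ≡ (just y , s′) → bump x (s ++ t) ≡ (just y , s′ ++ t)
bump-++-just x []      t ()
bump-++-just x (z ∷ s) t eq with x <ᵇ z
bump-++-just x (z ∷ s) t refl | true = refl
... | false with bump x s in e
... | just _ , _ rewrite bump-++-just x s t e with refl ← eq = refl
bump-++-just x (z ∷ s) t () | false | nothing , _

bump-nothing : ∀ x s {s′} → bump x s ≡ (nothing , s′) → s′ ≡ s ++ [ x ]
bump-nothing x s e =
  cong proj₂ (trans (sym e) (subst (λ t → bump x t ≡ (nothing , s ++ [ x ])) (++-identityʳ s) (bump-++-nothing x s [] e)))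

bump-bumped-> : ∀ x l {y l′} → bump x l ≡ (just y , l′) → x < y
bump-bumped-> x (z ∷ l) eq with x <ᵇ z in x<ᵇz
... | true with refl ← eq = <ᵇ⇒< x z (subst T (sym x<ᵇz) tt)
... | false with bump x l in e
...   | just _ , _ with refl ← eq = bump-bumped-> x l e
bump-bumped-> x (z ∷ l) () | false | nothing , _

bump-All : ∀ {P : ℕ → Set} x s → P x → All P s → Maybe.All P (proj₁ (bump x s)) × All P (proj₂ (bump x s))
bump-All x []      px []         = nothing , px ∷ []
bump-All x (y ∷ s) px (py ∷ ps) with x <ᵇ y
... | true = just py , px ∷ ps
... | false with bump x s | bump-All x s px ps
...   | _ , _ | pm , ps′ = pm , py ∷ ps′

rowInsert-All : ∀ {P : ℕ → Set} x T → P x → AllT P T → AllT P (rowInsert x T)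
rowInsert-All x []      px []        = (px ∷ []) ∷ []
rowInsert-All x (r ∷ T) px (pr ∷ pT) with bump x r | bump-All x r px pr
... | nothing , _ | _      , pr′ = pr′ ∷ pT
... | just y  , _ | just py , pr′ = pr′ ∷ rowInsert-All y T py pT

insertAll-All : ∀ {P : ℕ → Set} T xs → AllT P T → All P xs → AllT P (insertAll T xs)
insertAll-All T []       pT []        = pT
insertAll-All T (x ∷ xs) pT (px ∷ ps) = insertAll-All (rowInsert x T) xs (rowInsert-All x T px pT) ps

insertAll-++ : ∀ T xs ys → insertAll T (xs ++ ys) ≡ insertAll (insertAll T xs) ys
insertAll-++ T []       ys = refl
insertAll-++ T (x ∷ xs) ys = insertAll-++ (rowInsert x T) xs ys

rowInsert-∥ : ∀ x S L → AllT (_< x) S → rowInsert x (S ∥ L) ≡ S ∥ rowInsert x L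
rowInsert-∥ x []      L       _ = refl
rowInsert-∥ x (s ∷ S) []      (s<x ∷ S<x) rewrite bump-all x s s<x = cong ((s ++ [ x ]) ∷_) (sym (∥-identityʳ S))
rowInsert-∥ x (s ∷ S) (l ∷ L) (s<x ∷ S<x) with bump x l in eq
... | nothing , _ rewrite bump-++-nothing x s l (bump-all x s s<x) | eq = refl
... | just y  , _ rewrite bump-++-nothing x s l (bump-all x s s<x) | eq =
  cong ((s ++ _) ∷_) (rowInsert-∥ y S L (AllT-map (λ p → <-trans p (bump-bumped-> x l eq)) S<x))

insertAll-∥ : ∀ S L xs → All (λ x → AllT (_< x) S) xs → insertAll (S ∥ L) xs ≡ S ∥ insertAll L xs
insertAll-∥ S L []       []        = refl
insertAll-∥ S L (x ∷ xs) (px ∷ ps) rewrite rowInsert-∥ x S L px = insertAll-∥ S (rowInsert x L) xs ps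

-- Inserting a largest letter among smaller ones

-- (S , r) stands for S with one extra entry, larger than all of S, at the end of row r.
Marked : Set
Marked = Tableau × ℕ

unmark : ℕ → Marked → Tableau
unmark M (S , r) = S ∥ single r M

rowInsertMarked : ℕ → Tableau → ℕ → Marked
rowInsertMarked x []      zero    = [ [ x ] ] , 1
rowInsertMarked x []      (suc r) = [ [ x ] ] , suc r
rowInsertMarked x (s ∷ S) zero    with bump x s
... | just y  , s′ = s′ ∷ rowInsert y S , zero
... | nothing , s′ = s′ ∷ S , 1
rowInsertMarked x (s ∷ S) (suc r) with bump x s
... | nothing , s′ = s′ ∷ S , suc r
... | just y  , s′ with rowInsertMarked y S r
...   | S′ , r′ = s′ ∷ S′ , suc r′

insertAllMarked : Marked → List ℕ → Marked
insertAllMarked m       []       = m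
insertAllMarked (S , r) (x ∷ xs) = insertAllMarked (rowInsertMarked x S r) xs

rowInsertMarked-All : ∀ b x S r → x < b → AllT (_< b) S → AllT (_< b) (proj₁ (rowInsertMarked x S r))
rowInsertMarked-All b x []      zero    x<b _ = (x<b ∷ []) ∷ []
rowInsertMarked-All b x []      (suc r) x<b _ = (x<b ∷ []) ∷ []
rowInsertMarked-All b x (s ∷ S) zero    x<b (s<b ∷ S<b) with bump x s | bump-All x s x<b s<b
... | just y  , _ | just y<b , s′<b = s′<b ∷ rowInsert-All y S y<b S<b
... | nothing , _ | _        , s′<b = s′<b ∷ S<b
rowInsertMarked-All b x (s ∷ S) (suc r) x<b (s<b ∷ S<b) with bump x s | bump-All x s x<b s<b
... | nothing , _ | _        , s′<b = s′<b ∷ S<b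
... | just y  , _ | just y<b , s′<b with rowInsertMarked y S r | rowInsertMarked-All b y S r y<b S<b
...   | _ , _ | S′<b = s′<b ∷ S′<b

insertAllMarked-All : ∀ b S r xs → All (_< b) xs → AllT (_< b) S → AllT (_< b) (proj₁ (insertAllMarked (S , r) xs))
insertAllMarked-All b S r []       []           S<b = S<b
insertAllMarked-All b S r (x ∷ xs) (x<b ∷ xs<b) S<b =
  insertAllMarked-All b _ _ xs xs<b (rowInsertMarked-All b x S r x<b S<b)

rowInsert-unmark : ∀ x M S r → x < M → AllT (_< M) S → rowInsert x (unmark M (S , r)) ≡ unmark M (rowInsertMarked x S r)
rowInsert-unmark x M []      zero    x<M _ rewrite <⇒<ᵇ≡true x<M = refl
rowInsert-unmark x M []      (suc r) x<M _ = refl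
rowInsert-unmark x M (s ∷ S) zero    x<M (s<M ∷ S<M) with bump x s in e
... | just y , s′ rewrite bump-++-just x s [ M ] e | ∥-identityʳ S | ∥-identityʳ (rowInsert y S) = refl
... | nothing , s′
  rewrite bump-++-nothing x s [ M ] e | <⇒<ᵇ≡true x<M | bump-nothing x s e | ++-identityʳ (s ++ [ x ]) | ∥-identityʳ S =
  cong ((s ++ [ x ]) ∷_) (trans (cong (rowInsert M) (sym (∥-identityʳ S))) (rowInsert-∥ M S [] S<M))
rowInsert-unmark x M (s ∷ S) (suc r) x<M (s<M ∷ S<M) rewrite ++-identityʳ s with bump x s in e | bump-All x s x<M s<M
... | nothing , s′ | _ rewrite ++-identityʳ s′ = refl
... | just y  , s′ | just y<M , _ with rowInsertMarked y S r | rowInsert-unmark y M S r y<M S<M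
...   | _ , _ | ih rewrite ++-identityʳ s′ = cong (s′ ∷_) ih

insertAll-unmark : ∀ M S r xs → All (_< M) xs → AllT (_< M) S →
  insertAll (unmark M (S , r)) xs ≡ unmark M (insertAllMarked (S , r) xs)
insertAll-unmark M S r []       []           _   = refl
insertAll-unmark M S r (x ∷ xs) (x<M ∷ xs<M) S<M rewrite rowInsert-unmark x M S r x<M S<M =
  insertAll-unmark M _ _ xs xs<M (rowInsertMarked-All M x S r x<M S<M)

P-unmark : ∀ M α β → All (_< M) α → All (_< M) β → P (α ++ M ∷ β) ≡ unmark M (insertAllMarked (P α , 0) β)
P-unmark M α β α<M β<M = begin
  P (α ++ M ∷ β)                         ≡⟨ insertAll-++ [] α (M ∷ β) ⟩
  insertAll (rowInsert M (P α)) β         ≡⟨ cong (λ T → insertAll (rowInsert M T) β) (sym (∥-identityʳ (P α))) ⟩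
  insertAll (rowInsert M (P α ∥ [])) β    ≡⟨ cong (λ T → insertAll T β) (rowInsert-∥ M (P α) [] Pα<M) ⟩
  insertAll (unmark M (P α , 0)) β        ≡⟨ insertAll-unmark M (P α) 0 β β<M Pα<M ⟩
  unmark M (insertAllMarked (P α , 0) β)  ∎
  where
  open ≡-Reasoning
  Pα<M : AllT (_< M) (P α)
  Pα<M = insertAll-All [] α [] α<M

-- Decreasing runs inserted next to a single box

ExceedsAt : ℕ → ℕ → List ℕ → Set
ExceedsAt r       M []       = ⊤
ExceedsAt zero    M (x ∷ xs) = M < x
ExceedsAt (suc r) M (x ∷ xs) = ExceedsAt r M xs

ExceedsAt-∷⁻ : ∀ r M y xs → Increasing (y ∷ xs) → ExceedsAt r M (y ∷ xs) → ExceedsAt r M xs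
ExceedsAt-∷⁻ r       M y []       _           _   = tt
ExceedsAt-∷⁻ zero    M y (x ∷ xs) (y<x ∷ _)   M<y = <-trans M<y y<x
ExceedsAt-∷⁻ (suc r) M y (x ∷ xs) (_ ∷ inc)   ex  = ExceedsAt-∷⁻ r M x xs inc ex

ExceedsAt-++⁻ʳ : ∀ r M xs ys → Increasing (xs ++ ys) → ExceedsAt r M (xs ++ ys) → ExceedsAt r M ys
ExceedsAt-++⁻ʳ r M []       ys inc ex = ex
ExceedsAt-++⁻ʳ r M (x ∷ xs) ys inc ex =
  ExceedsAt-++⁻ʳ r M xs ys (Linked-tail inc) (ExceedsAt-∷⁻ r M x (xs ++ ys) inc ex)

ExceedsAt-++ : ∀ r M xs ys → length xs ≤ r → All (M <_) ys → ExceedsAt r M (xs ++ ys)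
ExceedsAt-++ r       M []       []       _         _          = tt
ExceedsAt-++ zero    M []       (y ∷ ys) _         (M<y ∷ _)  = M<y
ExceedsAt-++ (suc r) M []       (y ∷ ys) _         (_ ∷ M<ys) = ExceedsAt-++ r M [] ys z≤n M<ys
ExceedsAt-++ (suc r) M (x ∷ xs) ys       (s≤s ≤r) M<ys      = ExceedsAt-++ r M xs ys ≤r M<ys

rowInsert-column : ∀ v V → Increasing (v ∷ V) → rowInsert v (column V) ≡ column (v ∷ V)
rowInsert-column v []      _           = refl
rowInsert-column v (y ∷ V) (v<y ∷ inc) rewrite <⇒<ᵇ≡true v<y = cong ([ v ] ∷_) (rowInsert-column y V inc)

rowInsert-single∥column : ∀ r M z V → Increasing (z ∷ V) → ExceedsAt r M (z ∷ V) →
  rowInsert z (single r M ∥ column V) ≡ single r M ∥ column (z ∷ V)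
rowInsert-single∥column zero    M z []      _           M<z rewrite ≥⇒<ᵇ≡false (<⇒≤ M<z) = refl
rowInsert-single∥column zero    M z (y ∷ V) (z<y ∷ inc) M<z rewrite ≥⇒<ᵇ≡false (<⇒≤ M<z) | <⇒<ᵇ≡true z<y =
  cong ((M ∷ z ∷ []) ∷_) (rowInsert-column y V inc)
rowInsert-single∥column (suc r) M z []      _           _  = cong ([ z ] ∷_) (sym (∥-identityʳ (single r M)))
rowInsert-single∥column (suc r) M z (y ∷ V) (z<y ∷ inc) ex rewrite <⇒<ᵇ≡true z<y =
  cong ([ z ] ∷_) (rowInsert-single∥column r M y V inc ex)

rowInsert-column∥single : ∀ r w z C → Increasing (z ∷ C) → r < length C →
  rowInsert z (column C ∥ single r w) ≡ column (z ∷ C) ∥ single r w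
rowInsert-column∥single zero    w z (x ∷ C) (z<x ∷ inc) _ rewrite <⇒<ᵇ≡true z<x | ∥-identityʳ (column C) =
  cong ((z ∷ w ∷ []) ∷_) (rowInsert-column x C inc)
rowInsert-column∥single (suc r) w z (x ∷ C) (z<x ∷ inc) (s≤s r<C) rewrite <⇒<ᵇ≡true z<x =
  cong ([ z ] ∷_) (rowInsert-column∥single r w x C inc r<C)

-- When the entry arriving in row r is smaller than M, it bumps M into the column and
-- the column entry w of row r is left behind to the right.
rowInsert-single∥column-displace : ∀ r M w z Ys R V → z ∷ V ≡ Ys ++ w ∷ R → length Ys ≡ suc r →
  Increasing (Ys ++ M ∷ R) → rowInsert z (single r M ∥ column V) ≡ column (Ys ++ M ∷ R) ∥ single r w
rowInsert-single∥column-displace zero    M w z (y ∷ [])      R V       refl refl (z<M ∷ inc) rewrite <⇒<ᵇ≡true z<M =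
  cong ((z ∷ w ∷ []) ∷_) (rowInsert-column M R inc)
rowInsert-single∥column-displace (suc r) M w z (y ∷ y′ ∷ Ys) R (v ∷ V) refl eq   (z<v ∷ inc) rewrite <⇒<ᵇ≡true z<v =
  cong ([ z ] ∷_) (rowInsert-single∥column-displace r M w v (v ∷ Ys) R V refl (suc-injective eq) inc)

insertAll-single∥column : ∀ r M a m V → Increasing (ascending a m ++ V) → ExceedsAt r M (ascending a m ++ V) →
  insertAll (single r M ∥ column V) (descending a m) ≡ single r M ∥ column (ascending a m ++ V)
insertAll-single∥column r M a zero    V _   _  = refl
insertAll-single∥column r M a (suc m) V inc ex = begin
  insertAll (rowInsert (a + m) (single r M ∥ column V)) (descending a m)
    ≡⟨ cong (λ T → insertAll T (descending a m))
            (rowInsert-single∥column r M (a + m) V (Increasing-++⁻ʳ (ascending a m) inc′)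
                                     (ExceedsAt-++⁻ʳ r M (ascending a m) _ inc′ ex′)) ⟩
  insertAll (single r M ∥ column (a + m ∷ V)) (descending a m)
    ≡⟨ insertAll-single∥column r M a m (a + m ∷ V) inc′ ex′ ⟩
  single r M ∥ column (ascending a m ++ a + m ∷ V)
    ≡⟨ cong (λ xs → single r M ∥ column xs) (sym (ascending-∷ʳ-++ a m V)) ⟩
  single r M ∥ column (ascending a (suc m) ++ V) ∎
  where
  open ≡-Reasoning
  inc′ : Increasing (ascending a m ++ a + m ∷ V)
  inc′ = subst Increasing (ascending-∷ʳ-++ a m V) inc
  ex′ : ExceedsAt r M (ascending a m ++ a + m ∷ V)
  ex′ = subst (ExceedsAt r M) (ascending-∷ʳ-++ a m V) ex

insertAll-column∥single : ∀ r w a m C → Increasing (ascending a m ++ C) → r < length C →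
  insertAll (column C ∥ single r w) (descending a m) ≡ column (ascending a m ++ C) ∥ single r w
insertAll-column∥single r w a zero    C _   _   = refl
insertAll-column∥single r w a (suc m) C inc r<C = begin
  insertAll (rowInsert (a + m) (column C ∥ single r w)) (descending a m)
    ≡⟨ cong (λ T → insertAll T (descending a m))
            (rowInsert-column∥single r w (a + m) C (Increasing-++⁻ʳ (ascending a m) inc′) r<C) ⟩
  insertAll (column (a + m ∷ C) ∥ single r w) (descending a m)
    ≡⟨ insertAll-column∥single r w a m (a + m ∷ C) inc′ (m<n⇒m<1+n r<C) ⟩
  column (ascending a m ++ a + m ∷ C) ∥ single r w
    ≡⟨ cong (λ xs → column xs ∥ single r w) (sym (ascending-∷ʳ-++ a m C)) ⟩
  column (ascending a (suc m) ++ C) ∥ single r w ∎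
  where
  open ≡-Reasoning
  inc′ : Increasing (ascending a m ++ a + m ∷ C)
  inc′ = subst Increasing (ascending-∷ʳ-++ a m C) inc

insertAll-single-descending : ∀ r M j →
  insertAll (single r M) (descending (suc M) j) ≡ single r M ∥ column (ascending (suc M) j)
insertAll-single-descending r M j = begin
  insertAll (single r M) (descending (suc M) j)
    ≡⟨ cong (λ T → insertAll T (descending (suc M) j)) (sym (∥-identityʳ (single r M))) ⟩
  insertAll (single r M ∥ column []) (descending (suc M) j)
    ≡⟨ insertAll-single∥column r M (suc M) j [] inc ex ⟩
  single r M ∥ column (ascending (suc M) j ++ [])
    ≡⟨ cong (λ xs → single r M ∥ column xs) (++-identityʳ _) ⟩
  single r M ∥ column (ascending (suc M) j) ∎
  where
  open ≡-Reasoning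
  inc : Increasing (ascending (suc M) j ++ [])
  inc = subst Increasing (sym (++-identityʳ (ascending (suc M) j))) (ascending-increasing (suc M) j)
  ex : ExceedsAt r M (ascending (suc M) j ++ [])
  ex = subst (ExceedsAt r M) (sym (++-identityʳ (ascending (suc M) j)))
             (ExceedsAt-++ r M [] (ascending (suc M) j) z≤n (ascending-> j ≤-refl))

-- The word I^n(L(k)) ⊕ (n) appended by A(σ,k), for c = ⌈k/2⌉ and j = ⌊k/2⌋.
A-tail : ℕ → ℕ → ℕ → List ℕ
A-tail n c j = descending (suc (n + c)) j ++ descending n c

insertAll-single-tail-≤ : ∀ r n c j → c ≤ r →
  insertAll (single r (n + c)) (A-tail n c j) ≡ single r (n + c) ∥ column (ascending n c ++ ascending (suc (n + c)) j)
insertAll-single-tail-≤ r n c j c≤r = begin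
  insertAll (single r M) (descending (suc M) j ++ descending n c)
    ≡⟨ insertAll-++ (single r M) (descending (suc M) j) (descending n c) ⟩
  insertAll (insertAll (single r M) (descending (suc M) j)) (descending n c)
    ≡⟨ cong (λ T → insertAll T (descending n c)) (insertAll-single-descending r M j) ⟩
  insertAll (single r M ∥ column V) (descending n c)
    ≡⟨ insertAll-single∥column r M n c V inc ex ⟩
  single r M ∥ column (ascending n c ++ V) ∎
  where
  open ≡-Reasoning
  M = n + c
  V = ascending (suc M) j
  inc : Increasing (ascending n c ++ V)
  inc = ascending-++-ascending-increasing n c j (n≤1+n M)
  ex : ExceedsAt r M (ascending n c ++ V)
  ex = ExceedsAt-++ r M (ascending n c) V (subst (_≤ r) (sym (length-ascending n c)) c≤r) (ascending-> j ≤-refl)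

insertAll-single∥column-displace : ∀ r e n j → let M = n + suc (r + e); R = ascending (2 + M) j in
  insertAll (single r M ∥ column (ascending (n + suc e) r ++ suc M ∷ R)) (descending n (suc e))
    ≡ column (ascending n (suc (r + e)) ++ M ∷ R) ∥ single r (suc M)
insertAll-single∥column-displace r e n j = begin
  insertAll (rowInsert (n + e) (single r M ∥ column (ascending (n + suc e) r ++ suc M ∷ R))) (descending n e)
    ≡⟨ cong (λ T → insertAll T (descending n e))
            (rowInsert-single∥column-displace r M (suc M) (n + e) Ys R _ displaced (length-ascending (n + e) (suc r)) incY) ⟩
  insertAll (column (Ys ++ M ∷ R) ∥ single r (suc M)) (descending n e)
    ≡⟨ insertAll-column∥single r (suc M) n e (Ys ++ M ∷ R) incC r<C ⟩
  column (ascending n e ++ Ys ++ M ∷ R) ∥ single r (suc M)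
    ≡⟨ cong (λ xs → column xs ∥ single r (suc M)) joined ⟩
  column (ascending n (suc (r + e)) ++ M ∷ R) ∥ single r (suc M) ∎
  where
  open ≡-Reasoning
  M  = n + suc (r + e)
  R  = ascending (2 + M) j
  Ys = ascending (n + e) (suc r)
  displaced : n + e ∷ ascending (n + suc e) r ++ suc M ∷ R ≡ Ys ++ suc M ∷ R
  displaced = cong (λ a → n + e ∷ ascending a r ++ suc M ∷ R) (+-suc n e)
  arith : ∀ n e r → n + e + suc r ≡ n + suc (r + e)
  arith = solve-∀
  incY : Increasing (Ys ++ M ∷ R)
  incY = ascending-++-increasing (n + e) (suc r) (≤-reflexive (arith n e r))
                                 (∷-ascending-increasing (2 + M) j (m<n⇒m<1+n (n<1+n M)))
  incC : Increasing (ascending n e ++ Ys ++ M ∷ R)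
  incC = ascending-++-increasing n e ≤-refl incY
  r<C : r < length (Ys ++ M ∷ R)
  r<C = ≤-trans (≤-reflexive (sym (length-ascending (n + e) (suc r))))
                (≤-trans (m≤m+n _ _) (≤-reflexive (sym (length-++ Ys))))
  joined : ascending n e ++ Ys ++ M ∷ R ≡ ascending n (suc (r + e)) ++ M ∷ R
  joined = trans (sym (++-assoc (ascending n e) Ys (M ∷ R)))
                 (cong (_++ M ∷ R) (trans (sym (ascending-+ n e (suc r)))
                                          (cong (ascending n) (trans (+-suc e r) (cong suc (+-comm e r))))))

insertAll-single-tail-> : ∀ r e n j → let c = suc (r + e); M = n + c in
  insertAll (single r M) (A-tail n c (suc j)) ≡ column (ascending n c ++ M ∷ ascending (2 + M) j) ∥ single r (suc M)
insertAll-single-tail-> r e n j = begin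
  insertAll (single r M) (descending (suc M) (suc j) ++ descending n c)
    ≡⟨ insertAll-++ (single r M) (descending (suc M) (suc j)) (descending n c) ⟩
  insertAll (insertAll (single r M) (descending (suc M) (suc j))) (descending n c)
    ≡⟨ cong (λ T → insertAll T (descending n c)) (insertAll-single-descending r M (suc j)) ⟩
  insertAll (single r M ∥ column V) (descending n c)
    ≡⟨ cong (insertAll (single r M ∥ column V)) split ⟩
  insertAll (single r M ∥ column V) (descending (n + suc e) r ++ descending n (suc e))
    ≡⟨ insertAll-++ (single r M ∥ column V) (descending (n + suc e) r) (descending n (suc e)) ⟩
  insertAll (insertAll (single r M ∥ column V) (descending (n + suc e) r)) (descending n (suc e))
    ≡⟨ cong (λ T → insertAll T (descending n (suc e))) (insertAll-single∥column r M (n + suc e) r V inc ex) ⟩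
  insertAll (single r M ∥ column (ascending (n + suc e) r ++ V)) (descending n (suc e))
    ≡⟨ insertAll-single∥column-displace r e n j ⟩
  column (ascending n c ++ M ∷ ascending (2 + M) j) ∥ single r (suc M) ∎
  where
  open ≡-Reasoning
  c = suc (r + e)
  M = n + c
  V = ascending (suc M) (suc j)
  split : descending n c ≡ descending (n + suc e) r ++ descending n (suc e)
  split = trans (cong (descending n) (sym (+-suc r e))) (descending-+ n r (suc e))
  arith : ∀ n e r → n + suc e + r ≡ n + suc (r + e)
  arith = solve-∀
  inc : Increasing (ascending (n + suc e) r ++ V)
  inc = ascending-++-ascending-increasing (n + suc e) r (suc j) (≤-trans (≤-reflexive (arith n e r)) (n≤1+n M))
  ex : ExceedsAt r M (ascending (n + suc e) r ++ V)
  ex = ExceedsAt-++ r M (ascending (n + suc e) r) V (≤-reflexive (length-ascending _ r)) (ascending-> (suc j) ≤-refl)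

Γ-insertAll-single-tail : ∀ r n c j → 1 ≤ j →
  Γ (insertAll (single r (n + c)) (A-tail n c j)) ≡ Γ (single r n) ⊞ ones (c + j)
Γ-insertAll-single-tail r n c j _ with c ≤? r
... | yes c≤r rewrite insertAll-single-tail-≤ r n c j c≤r = begin
  Γ (single r (n + c) ∥ column V)            ≡⟨ Γ-∥ (single r (n + c)) (column V) ⟩
  Γ (single r (n + c)) ⊞ Γ (column V)        ≡⟨ cong₂ _⊞_ (Γ-single r (n + c) n) (Γ-column V) ⟩
  Γ (single r n) ⊞ ones (length V)           ≡⟨ cong (λ l → Γ (single r n) ⊞ ones l) lengthV ⟩
  Γ (single r n) ⊞ ones (c + j)              ∎
  where
  open ≡-Reasoning
  V = ascending n c ++ ascending (suc (n + c)) j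
  lengthV : length V ≡ c + j
  lengthV = trans (length-++ (ascending n c)) (cong₂ _+_ (length-ascending n c) (length-ascending _ j))
Γ-insertAll-single-tail r n c (suc j) _ | no c≰r with m≤n⇒∃[o]m+o≡n (≰⇒> c≰r)
... | e , refl rewrite insertAll-single-tail-> r e n j = begin
  Γ (column C ∥ single r (suc M))            ≡⟨ Γ-∥ (column C) (single r (suc M)) ⟩
  Γ (column C) ⊞ Γ (single r (suc M))        ≡⟨ ⊞-comm (Γ (column C)) _ ⟩
  Γ (single r (suc M)) ⊞ Γ (column C)        ≡⟨ cong₂ _⊞_ (Γ-single r (suc M) n) (Γ-column C) ⟩
  Γ (single r n) ⊞ ones (length C)           ≡⟨ cong (λ l → Γ (single r n) ⊞ ones l) lengthC ⟩
  Γ (single r n) ⊞ ones (suc (r + e) + suc j) ∎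
  where
  open ≡-Reasoning
  M = n + suc (r + e)
  C = ascending n (suc (r + e)) ++ M ∷ ascending (2 + M) j
  lengthC : length C ≡ suc (r + e) + suc j
  lengthC = trans (length-++ (ascending n (suc (r + e))))
                  (cong₂ _+_ (length-ascending n (suc (r + e))) (cong suc (length-ascending (2 + M) j)))

map-suc-downFrom : ∀ m → map suc (downFrom m) ≡ descending 1 m
map-suc-downFrom zero    = refl
map-suc-downFrom (suc m) = cong (suc m ∷_) (map-suc-downFrom m)

L-≡ : ∀ k c → ⌈ k /2⌉ ≡ suc c → L k ≡ descending (2 + c) ⌊ k /2⌋ ++ descending 1 c
L-≡ k c k/2≡1+c = begin
  filter P? (map suc (downFrom k))
    ≡⟨ cong (filter P?) (trans (map-suc-downFrom k) (cong (descending 1) (sym k≡))) ⟩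
  filter P? (descending 1 (⌊ k /2⌋ + suc c))
    ≡⟨ cong (filter P?) (descending-+ 1 ⌊ k /2⌋ (suc c)) ⟩
  filter P? (descending (2 + c) ⌊ k /2⌋ ++ suc c ∷ descending 1 c)
    ≡⟨ filter-++ P? (descending (2 + c) ⌊ k /2⌋) _ ⟩
  filter P? (descending (2 + c) ⌊ k /2⌋) ++ filter P? (suc c ∷ descending 1 c)
    ≡⟨ cong₂ _++_ (filter-all P? above) (trans (filter-reject P? (λ ne → ne (sym k/2≡1+c))) (filter-all P? below)) ⟩
  descending (2 + c) ⌊ k /2⌋ ++ descending 1 c ∎
  where
  open ≡-Reasoning
  P? = λ x → ¬? (x ≟ ⌈ k /2⌉)
  k≡ : ⌊ k /2⌋ + suc c ≡ k
  k≡ = trans (cong (⌊ k /2⌋ +_) (sym k/2≡1+c)) (⌊n/2⌋+⌈n/2⌉≡n k)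
  above : All (λ x → x ≢ ⌈ k /2⌉) (descending (2 + c) ⌊ k /2⌋)
  above = All.map (λ c<x x≡ → <-irrefl (sym (trans x≡ k/2≡1+c)) c<x) (descending-≥ ⌊ k /2⌋ ≤-refl)
  below : All (λ x → x ≢ ⌈ k /2⌉) (descending 1 c)
  below = All.map (λ x<c x≡ → <-irrefl (trans x≡ k/2≡1+c) x<c) (descending-< 1 c ≤-refl)

Iter-I-L-∷ʳ : ∀ n k c → ⌈ k /2⌉ ≡ suc c → Iter-I n (L k) ++ [ n ] ≡ A-tail n (suc c) ⌊ k /2⌋
Iter-I-L-∷ʳ n k c k/2≡1+c = begin
  map (n +_) (L k) ++ [ n ]
    ≡⟨ cong (λ xs → map (n +_) xs ++ [ n ]) (L-≡ k c k/2≡1+c) ⟩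
  map (n +_) (descending (2 + c) j ++ descending 1 c) ++ [ n ]
    ≡⟨ cong (_++ [ n ]) (map-++ (n +_) (descending (2 + c) j) (descending 1 c)) ⟩
  (map (n +_) (descending (2 + c) j) ++ map (n +_) (descending 1 c)) ++ [ n ]
    ≡⟨ ++-assoc (map (n +_) (descending (2 + c) j)) _ _ ⟩
  map (n +_) (descending (2 + c) j) ++ map (n +_) (descending 1 c) ++ [ n ]
    ≡⟨ cong₂ _++_ (trans (map-descending n (2 + c) j) (cong (λ a → descending a j) (+-suc n (suc c))))
                  (trans (cong (_++ [ n ]) (map-descending n 1 c)) (sym lowest)) ⟩
  descending (suc (n + suc c)) j ++ descending n (suc c) ∎
  where
  open ≡-Reasoning
  j = ⌊ k /2⌋
  lowest : descending n (suc c) ≡ descending (n + 1) c ++ [ n ]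
  lowest = trans (cong (descending n) (+-comm 1 c))
                 (trans (descending-+ n c 1) (cong (λ t → descending (n + 1) c ++ [ t ]) (+-identityʳ n)))

relabel-≡ : ∀ n v α β → All (_< n) α → All (_< n) β →
  map (λ x → if ⌊ x ≟ n ⌋ then v else x) (α ++ n ∷ β) ≡ α ++ v ∷ β
relabel-≡ n v α β α<n β<n =
  trans (map-++ _ α (n ∷ β)) (cong₂ _++_ (fixes α<n) (cong₂ _∷_ moves (fixes β<n)))
  where
  moves : (if ⌊ n ≟ n ⌋ then v else n) ≡ v
  moves = cong (λ d → if ⌊ d ⌋ then v else n) (≟-diag refl)
  fixes : ∀ {xs} → All (_< n) xs → map (λ x → if ⌊ x ≟ n ⌋ then v else x) xs ≡ xs
  fixes []                 = refl
  fixes {x ∷ _} (x<n ∷ ps) with x ≟ n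
  ... | yes x≡n = contradiction x≡n (<⇒≢ x<n)
  ... | no _    = cong (x ∷_) (fixes ps)

A-≡ : ∀ n α β k c → ⌈ k /2⌉ ≡ suc c → All (_< n) α → All (_< n) β →
  A n (α ++ n ∷ β) k ≡ (α ++ n + suc c ∷ β) ++ A-tail n (suc c) ⌊ k /2⌋
A-≡ n α β k c k/2≡1+c α<n β<n =
  cong₂ _++_ (trans (relabel-≡ n (n + ⌈ k /2⌉) α β α<n β<n) (cong (λ v → α ++ n + v ∷ β) k/2≡1+c))
             (Iter-I-L-∷ʳ n k c k/2≡1+c)

Γ-P-++-tail : ∀ n α β c j → 1 ≤ j → All (_< n) α → All (_< n) β →
  Γ (P ((α ++ n + c ∷ β) ++ A-tail n c j)) ≡ Γ (P (α ++ n ∷ β)) ⊞ ones (c + j)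
Γ-P-++-tail n α β c j 1≤j α<n β<n = begin
  Γ (P ((α ++ M ∷ β) ++ τ))              ≡⟨ cong Γ (insertAll-++ [] (α ++ M ∷ β) τ) ⟩
  Γ (insertAll (P (α ++ M ∷ β)) τ)        ≡⟨ cong (λ Q → Γ (insertAll Q τ)) (P-unmark M α β (raise α<n) (raise β<n)) ⟩
  Γ (insertAll (S ∥ single r M) τ)        ≡⟨ cong Γ (insertAll-∥ S (single r M) τ τ>S) ⟩
  Γ (S ∥ insertAll (single r M) τ)        ≡⟨ Γ-∥ S _ ⟩
  Γ S ⊞ Γ (insertAll (single r M) τ)      ≡⟨ cong (Γ S ⊞_) (Γ-insertAll-single-tail r n c j 1≤j) ⟩
  Γ S ⊞ (Γ (single r n) ⊞ ones (c + j))   ≡⟨ sym (⊞-assoc (Γ S) _ _) ⟩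
  (Γ S ⊞ Γ (single r n)) ⊞ ones (c + j)   ≡⟨ cong (_⊞ ones (c + j)) (sym (Γ-∥ S (single r n))) ⟩
  Γ (S ∥ single r n) ⊞ ones (c + j)       ≡⟨ cong (λ Q → Γ Q ⊞ ones (c + j)) (sym (P-unmark n α β α<n β<n)) ⟩
  Γ (P (α ++ n ∷ β)) ⊞ ones (c + j)       ∎
  where
  open ≡-Reasoning
  M = n + c
  S = proj₁ (insertAllMarked (P α , 0) β)
  r = proj₂ (insertAllMarked (P α , 0) β)
  raise : ∀ {xs} → All (_< n) xs → All (_< M) xs
  raise = All.map (λ x<n → <-≤-trans x<n (m≤m+n n c))
  S<n : AllT (_< n) S
  S<n = insertAllMarked-All n (P α) 0 β β<n (insertAll-All [] α [] α<n)
  τ = A-tail n c j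
  τ>S : All (λ x → AllT (_< x) S) τ
  τ>S = All.map (λ n≤x → AllT-map (λ y<n → <-≤-trans y<n n≤x) S<n)
                (++⁺ (descending-≥ j (≤-trans (m≤m+n n c) (n≤1+n M))) (descending-≥ c ≤-refl))

oneTo-∷ʳ : ∀ m → oneTo (suc m) ≡ oneTo m ++ [ suc m ]
oneTo-∷ʳ m = trans (cong (map suc) (sym (upTo-∷ʳ m))) (map-++ suc (upTo m) [ m ])

∈-oneTo⁻ : ∀ m {x} → x ∈ oneTo m → 1 ≤ x × x ≤ m
∈-oneTo⁻ m x∈ with ∈-map⁻ suc x∈
... | z , z∈ , refl = s≤s z≤n , ∈-upTo⁻ z∈

oneTo-+ : ∀ m t → oneTo (m + t) ↭ oneTo m ++ descending (suc m) t
oneTo-+ m zero = ↭-reflexive (trans (cong oneTo (+-identityʳ m)) (sym (++-identityʳ _)))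
oneTo-+ m (suc t) = begin
  oneTo (m + suc t)                                   ≡⟨ cong oneTo (+-suc m t) ⟩
  oneTo (suc (m + t))                                 ≡⟨ oneTo-∷ʳ (m + t) ⟩
  oneTo (m + t) ++ [ suc (m + t) ]                    ↭⟨ ++⁺ʳ _ (oneTo-+ m t) ⟩
  (oneTo m ++ descending (suc m) t) ++ [ suc m + t ]  ≡⟨ ++-assoc (oneTo m) _ _ ⟩
  oneTo m ++ descending (suc m) t ++ [ suc m + t ]    ↭⟨ ++⁺ˡ (oneTo m) (↭.++-comm (descending (suc m) t) _) ⟩
  oneTo m ++ descending (suc m) (suc t)               ∎
  where open PermutationReasoning

IsPerm-split : ∀ m σ → IsPerm (suc m) σ →
  ∃₂ λ α β → σ ≡ α ++ suc m ∷ β × All (_< suc m) α × All (_< suc m) β × IsPerm m (α ++ β)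
IsPerm-split m σ σ↭ with ∈-∃++ (Any-resp-↭ (↭-sym σ↭) (∈-map⁺ suc (∈-upTo⁺ (n<1+n m))))
... | α , β , refl = α , β , refl , All.++⁻ˡ α αβ<n , All.++⁻ʳ α αβ<n , αβ↭
  where
  αβ↭ : α ++ β ↭ oneTo m
  αβ↭ = subst (α ++ β ↭_) (++-identityʳ (oneTo m))
              (drop-mid α (oneTo m) (subst (α ++ suc m ∷ β ↭_) (oneTo-∷ʳ m) σ↭))
  αβ<n : All (_< suc m) (α ++ β)
  αβ<n = All-resp-↭ (↭-sym αβ↭) (All.tabulate (λ x∈ → s≤s (proj₂ (∈-oneTo⁻ m x∈))))

IsPerm-++-tail : ∀ m α β c j → IsPerm m (α ++ β) →
  IsPerm (suc m + (j + c)) ((α ++ suc m + c ∷ β) ++ A-tail (suc m) c j)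
IsPerm-++-tail m α β c j αβ↭ = begin
  (α ++ M ∷ β) ++ tl                         ≡⟨ ++-assoc α (M ∷ β) tl ⟩
  α ++ M ∷ β ++ tl                           ↭⟨ shift M α (β ++ tl) ⟩
  M ∷ α ++ β ++ tl                           ≡⟨ cong (M ∷_) (sym (++-assoc α β tl)) ⟩
  M ∷ (α ++ β) ++ tl                         ↭⟨ ↭-sym (shift M (α ++ β) tl) ⟩
  (α ++ β) ++ M ∷ tl                         ↭⟨ ++⁺ʳ (M ∷ tl) αβ↭ ⟩
  oneTo m ++ M ∷ tl                          ↭⟨ ++⁺ˡ (oneTo m) (↭-sym (shift M (descending (suc M) j) (descending n c))) ⟩
  oneTo m ++ descending (suc M) j ++ M ∷ descending n c  ≡⟨ cong (oneTo m ++_) (sym values) ⟩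
  oneTo m ++ descending n (j + suc c)       ↭⟨ ↭-sym (oneTo-+ m (j + suc c)) ⟩
  oneTo (m + (j + suc c))                   ≡⟨ cong oneTo (trans (cong (m +_) (+-suc j c)) (+-suc m (j + c))) ⟩
  oneTo (suc m + (j + c))                   ∎
  where
  open PermutationReasoning
  n = suc m
  M = n + c
  tl = A-tail n c j
  values : descending n (j + suc c) ≡ descending (suc M) j ++ M ∷ descending n c
  values = trans (descending-+ n j (suc c)) (cong (λ a → descending a j ++ M ∷ descending n c) (+-suc n c))

apply-++ˡ : ∀ xs ys i → suc i ≤ length xs → apply (xs ++ ys) (suc i) ≡ apply xs (suc i)
apply-++ˡ (x ∷ xs) ys zero    _         = refl
apply-++ˡ (x ∷ xs) ys (suc i) (s≤s i<) = apply-++ˡ xs ys i i<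

apply-++ʳ : ∀ xs ys t → apply (xs ++ ys) (suc (length xs + t)) ≡ apply ys (suc t)
apply-++ʳ []       ys t = refl
apply-++ʳ (x ∷ xs) ys t = apply-++ʳ xs ys t

apply-map : ∀ (f : ℕ → ℕ) xs i → suc i ≤ length xs → apply (map f xs) (suc i) ≡ f (apply xs (suc i))
apply-map f (x ∷ xs) zero    _         = refl
apply-map f (x ∷ xs) (suc i) (s≤s i<) = apply-map f xs i i<

apply-∈ : ∀ xs i → suc i ≤ length xs → apply xs (suc i) ∈ xs
apply-∈ (x ∷ xs) zero    _         = here refl
apply-∈ (x ∷ xs) (suc i) (s≤s i<) = there (apply-∈ xs i i<)

apply-descending : ∀ a u v → apply (descending a (suc (u + v))) (suc u) ≡ a + v
apply-descending a zero    v = refl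
apply-descending a (suc u) v = apply-descending a u v

iter-+ : ∀ (f : ℕ → ℕ) p q x → iter f (p + q) x ≡ iter f p (iter f q x)
iter-+ f zero    q x = refl
iter-+ f (suc p) q x = cong f (iter-+ f p q x)

Reaches : (ℕ → ℕ) → ℕ → ℕ → Set
Reaches f x y = ∃ λ q → iter f q x ≡ y

reaches-≡ : ∀ {f x y} → x ≡ y → Reaches f x y
reaches-≡ x≡y = 0 , x≡y

reaches-step : ∀ {f x y} → f x ≡ y → Reaches f x y
reaches-step fx≡y = 1 , fx≡y

reaches-trans : ∀ {f x y z} → Reaches f x y → Reaches f y z → Reaches f x z
reaches-trans {f} {x} (p , fᵖx≡y) (q , fᵠy≡z) =
  q + p , trans (iter-+ f q p x) (trans (cong (iter f q) fᵖx≡y) fᵠy≡z)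

reaches-iter : ∀ {a s : ℕ → ℕ} (R : ℕ → Set) →
  (∀ {x} → R x → R (s x)) → (∀ {x} → R x → Reaches a x (s x)) →
  ∀ {x} → R x → ∀ i → Reaches a x (iter s i x)
reaches-iter {a} {s} R s-R simulate {x} Rx i = go i
  where
  R-iter : ∀ i → R (iter s i x)
  R-iter zero    = Rx
  R-iter (suc i) = s-R (R-iter i)
  go : ∀ i → Reaches a x (iter s i x)
  go zero    = reaches-≡ refl
  go (suc i) = reaches-trans (go i) (simulate (R-iter i))

-- From n + c the orbit then alternates between the two sides of n + c, one step further out each time.
module Zigzag (a : ℕ → ℕ) (n j c : ℕ)
  (upper : ∀ u v → suc (u + v) ≡ j → a (n + suc u) ≡ n + suc (c + v))
  (lower : ∀ u w → suc (u + w) ≡ c → a (n + (j + suc u)) ≡ n + w) where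

  module Even (c≡j : c ≡ j) where
    ascend  : ∀ i v → suc (i + v) ≡ c → Reaches a (n + c) (n + suc (c + i))
    descend : ∀ i v → i + v ≡ c → Reaches a (n + c) (n + v)

    ascend i v eq = reaches-trans (descend i (suc v) (trans (+-suc i v) eq))
                                  (reaches-step (upper v i (trans (cong suc (+-comm v i)) (trans eq c≡j))))

    descend zero    v eq = reaches-≡ (cong (n +_) (sym eq))
    descend (suc i) v eq =
      reaches-trans (ascend i v eq) (reaches-step (trans (cong (λ t → a (n + t)) position) (lower i v eq)))
      where
      position : suc (c + i) ≡ j + suc i
      position = trans (cong (λ t → suc (t + i)) c≡j) (sym (+-suc j i))

    1+i≤c : ∀ i → suc c + i ≤ j + c → suc i ≤ c
    1+i≤c i le =
      +-cancelˡ-≤ c (suc i) c (≤-trans (≤-reflexive (+-suc c i)) (subst (λ t → suc c + i ≤ t + c) (sym c≡j) le))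

    reach : ∀ u → u ≤ j + c → Reaches a (n + c) (n + u)
    reach u u≤ with u ≤? c
    ... | yes u≤c with m≤n⇒∃[o]m+o≡n u≤c
    ...   | i , u+i≡c = descend i u (trans (+-comm i u) u+i≡c)
    reach u u≤ | no u≰c with m≤n⇒∃[o]m+o≡n (≰⇒> u≰c)
    ...   | i , refl with m≤n⇒∃[o]m+o≡n (1+i≤c i u≤)
    ...     | v , eq = ascend i v eq

  module Odd (c≡1+j : c ≡ suc j) where
    position : ∀ i → c + i ≡ j + suc i
    position i = trans (cong (_+ i) c≡1+j) (sym (+-suc j i))

    1+i≤j : ∀ i → c + suc i ≤ j + c → suc i ≤ j
    1+i≤j i le = +-cancelʳ-≤ c (suc i) j (subst (_≤ j + c) (+-comm c (suc i)) le)

    ascend : ∀ i → c + i ≤ j + c → Reaches a (n + c) (n + (c + i))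
    ascend zero    _  = reaches-≡ (cong (n +_) (sym (+-identityʳ c)))
    ascend (suc i) le with m≤n⇒∃[o]m+o≡n (1+i≤j i le)
    ... | w , 1+i+w≡j = reaches-trans (ascend i (≤-trans (+-monoʳ-≤ c (n≤1+n i)) le))
                          (reaches-trans (reaches-step down) (reaches-step up))
      where
      down : a (n + (c + i)) ≡ n + suc w
      down = trans (cong (λ t → a (n + t)) (position i))
                   (lower i (suc w) (trans (cong suc (+-suc i w)) (trans (cong suc 1+i+w≡j) (sym c≡1+j))))
      up : a (n + suc w) ≡ n + (c + suc i)
      up = trans (upper w i (trans (cong suc (+-comm w i)) 1+i+w≡j)) (cong (n +_) (sym (+-suc c i)))

    descend : ∀ i w → suc (i + w) ≡ c → Reaches a (n + c) (n + w)
    descend i w eq =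
      reaches-trans (ascend i c+i≤) (reaches-step (trans (cong (λ t → a (n + t)) (position i)) (lower i w eq)))
      where
      c+i≤ : c + i ≤ j + c
      c+i≤ = subst (c + i ≤_) (+-comm c j) (+-monoʳ-≤ c (subst (i ≤_) (suc-injective (trans eq c≡1+j)) (m≤m+n i w)))

    reach : ∀ u → u ≤ j + c → Reaches a (n + c) (n + u)
    reach u u≤ with c ≤? u
    ... | yes c≤u with m≤n⇒∃[o]m+o≡n c≤u
    ...   | i , refl = ascend i u≤
    reach u u≤ | no c≰u with m≤n⇒∃[o]m+o≡n (≰⇒> c≰u)
    ...   | i , eq = descend i u (trans (cong suc (+-comm i u)) eq)

  reach : c ≡ j ⊎ c ≡ suc j → ∀ u → u ≤ j + c → Reaches a (n + c) (n + u)
  reach (inj₁ c≡j)   = Even.reach c≡j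
  reach (inj₂ c≡1+j) = Odd.reach c≡1+j

-- Cyclicity of A(σ,k)

module _ (m : ℕ) (α β : List ℕ) (c j : ℕ) (balanced : c ≡ j ⊎ c ≡ suc j)
         (α<n : All (_< suc m) α) (β<n : All (_< suc m) β)
         (σ↭ : IsPerm (suc m) (α ++ suc m ∷ β)) (cyc : IsCyclic (suc m) (α ++ suc m ∷ β)) where
  private
    n = suc m
    M = n + c
    σ = α ++ n ∷ β
    s = apply σ
    a = apply ((α ++ M ∷ β) ++ A-tail n c j)

    relabel : ℕ → ℕ
    relabel x = if ⌊ x ≟ n ⌋ then M else x

    relabel-≢ : ∀ {y} → y ≢ n → relabel y ≡ y
    relabel-≢ {y} y≢n with y ≟ n
    ... | yes y≡n = contradiction y≡n y≢n
    ... | no  _   = refl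

    relabel-n : relabel n ≡ M
    relabel-n = cong (λ d → if ⌊ d ⌋ then M else n) (≟-diag refl)

    length-σ : length σ ≡ n
    length-σ = trans (↭.↭-length σ↭) (trans (length-map suc (upTo n)) (length-upTo n))

    length-relabelled : length (α ++ M ∷ β) ≡ n
    length-relabelled = trans (length-++ α) (trans (sym (length-++ α)) length-σ)

    a-below : ∀ i → suc i ≤ n → a (suc i) ≡ relabel (s (suc i))
    a-below i i< = begin
      apply ((α ++ M ∷ β) ++ A-tail n c j) (suc i)
        ≡⟨ apply-++ˡ (α ++ M ∷ β) _ i (subst (suc i ≤_) (sym length-relabelled) i<) ⟩
      apply (α ++ M ∷ β) (suc i)
        ≡⟨ cong (λ xs → apply xs (suc i)) (sym (relabel-≡ n M α β α<n β<n)) ⟩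
      apply (map relabel σ) (suc i)
        ≡⟨ apply-map relabel σ i (subst (suc i ≤_) (sym length-σ) i<) ⟩
      relabel (s (suc i)) ∎
      where open ≡-Reasoning

    s-range : ∀ {x} → 1 ≤ x × x ≤ n → 1 ≤ s x × s x ≤ n
    s-range {suc i} (_ , i<) = ∈-oneTo⁻ n (Any-resp-↭ σ↭ (apply-∈ σ i (subst (suc i ≤_) (sym length-σ) i<)))

    a-above : ∀ t → a (n + suc t) ≡ apply (A-tail n c j) (suc t)
    a-above t = trans (cong a (trans (+-suc n t) (cong (λ l → suc (l + t)) (sym length-relabelled))))
                      (apply-++ʳ (α ++ M ∷ β) (A-tail n c j) t)

    upper : ∀ u v → suc (u + v) ≡ j → a (n + suc u) ≡ n + suc (c + v)
    upper u v 1+u+v≡j = begin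
      a (n + suc u)                                      ≡⟨ a-above u ⟩
      apply (descending (suc M) j ++ descending n c) (suc u)
        ≡⟨ apply-++ˡ (descending (suc M) j) _ u
                     (subst (suc u ≤_) (sym (length-descending (suc M) j)) (≤-trans (s≤s (m≤m+n u v)) (≤-reflexive 1+u+v≡j))) ⟩
      apply (descending (suc M) j) (suc u)               ≡⟨ cong (λ l → apply (descending (suc M) l) (suc u)) (sym 1+u+v≡j) ⟩
      apply (descending (suc M) (suc (u + v))) (suc u)   ≡⟨ apply-descending (suc M) u v ⟩
      suc M + v                                          ≡⟨ trans (cong suc (+-assoc n c v)) (sym (+-suc n (c + v))) ⟩
      n + suc (c + v)                                    ∎
      where open ≡-Reasoning

    lower : ∀ u w → suc (u + w) ≡ c → a (n + (j + suc u)) ≡ n + w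
    lower u w 1+u+w≡c = begin
      a (n + (j + suc u))                                ≡⟨ cong (λ t → a (n + t)) (+-suc j u) ⟩
      a (n + suc (j + u))                                ≡⟨ a-above (j + u) ⟩
      apply (descending (suc M) j ++ descending n c) (suc (j + u))
        ≡⟨ cong (λ l → apply (descending (suc M) j ++ descending n c) (suc (l + u))) (sym (length-descending (suc M) j)) ⟩
      apply (descending (suc M) j ++ descending n c) (suc (length (descending (suc M) j) + u))
        ≡⟨ apply-++ʳ (descending (suc M) j) (descending n c) u ⟩
      apply (descending n c) (suc u)                     ≡⟨ cong (λ l → apply (descending n l) (suc u)) (sym 1+u+w≡c) ⟩
      apply (descending n (suc (u + w))) (suc u)         ≡⟨ apply-descending n u w ⟩
      n + w                                              ∎
      where open ≡-Reasoning

    open Zigzag a n j c upper lower using (reach)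

    -- A step of σ into n becomes, in the relabelled word, a step to M followed by the whole zigzag back to n.
    simulate : ∀ {x} → 1 ≤ x × x ≤ n → Reaches a x (s x)
    simulate {suc i} (_ , i<) with s (suc i) ≟ n
    ... | no  sx≢n = reaches-step (trans (a-below i i<) (relabel-≢ sx≢n))
    ... | yes sx≡n = reaches-trans (reaches-step (trans (a-below i i<) (trans (cong relabel sx≡n) relabel-n)))
                                   (subst (Reaches a M) (trans (+-identityʳ n) (sym sx≡n)) (reach balanced 0 z≤n))

    orbit : ∀ i → Reaches a 1 (iter s i 1)
    orbit = reaches-iter (λ x → 1 ≤ x × x ≤ n) s-range simulate (≤-refl , s≤s z≤n)

    p = suc (length α + 0)

    s-p : s p ≡ n
    s-p = apply-++ʳ α (n ∷ β) 0

    p≤n : p ≤ n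
    p≤n = ≤-trans (≤-reflexive (sym (+-suc (length α) 0)))
                  (≤-trans (+-monoʳ-≤ (length α) (s≤s z≤n)) (≤-reflexive (trans (sym (length-++ α)) length-σ)))

    1↝M : Reaches a 1 M
    1↝M with cyc p (s≤s z≤n) p≤n
    ... | i , sⁱ1≡p = reaches-trans (subst (Reaches a 1) sⁱ1≡p (orbit i))
                                    (reaches-step (trans (a-below (length α + 0) p≤n) (trans (cong relabel s-p) relabel-n)))

  IsCyclic-++-tail : IsCyclic (suc m + (j + c)) ((α ++ suc m + c ∷ β) ++ A-tail (suc m) c j)
  IsCyclic-++-tail J 1≤J J≤ with J ≤? n
  ... | yes J≤n with cyc J 1≤J J≤n
  ...   | i , sⁱ1≡J = subst (Reaches a 1) sⁱ1≡J (orbit i)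
  IsCyclic-++-tail J 1≤J J≤ | no J≰n with m≤n⇒∃[o]m+o≡n (≰⇒> J≰n)
  ...   | u , refl = reaches-trans 1↝M (subst (Reaches a M) (+-suc n u) (reach balanced (suc u) 1+u≤))
    where
    1+u≤ : suc u ≤ j + c
    1+u≤ = +-cancelˡ-≤ n (suc u) (j + c) (subst (_≤ n + (j + c)) (sym (+-suc n u)) J≤)

lemma3p14 : (n : ℕ) (σ : List ℕ) (k : ℕ) →
    1 ≤ n → IsPerm n σ → IsCyclic n σ → 1 < k →
    (IsPerm (n + k) (A n σ k) × IsCyclic (n + k) (A n σ k))
    × Γ (P (A n σ k)) ≡ (Γ (P σ) ⊞ ones k)
lemma3p14 (suc m) σ (suc zero) _ _ _ (s≤s ())
lemma3p14 (suc m) σ k@(suc (suc k′)) _ σ↭ cyc _ with IsPerm-split m σ σ↭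
... | α , β , refl , α<n , β<n , αβ↭ rewrite A-≡ (suc m) α β k ⌈ k′ /2⌉ refl α<n β<n =
  (subst (λ l → IsPerm (n + l) w) j+c≡k perm , subst (λ l → IsCyclic (n + l) w) j+c≡k cyclic) ,
  subst (λ l → Γ (P w) ≡ Γ (P (α ++ n ∷ β)) ⊞ ones l) (trans (+-comm c j) j+c≡k) shape
  where
  n = suc m
  c = suc ⌈ k′ /2⌉
  j = ⌊ k /2⌋
  w = (α ++ n + c ∷ β) ++ A-tail n c j
  j+c≡k : j + c ≡ k
  j+c≡k = ⌊n/2⌋+⌈n/2⌉≡n k
  perm : IsPerm (n + (j + c)) w
  perm = IsPerm-++-tail m α β c j αβ↭
  cyclic : IsCyclic (n + (j + c)) w
  cyclic = IsCyclic-++-tail m α β c j (⌈n/2⌉≡⌊n/2⌋⊎1+⌊n/2⌋ k) α<n β<n σ↭ cyc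
  shape : Γ (P w) ≡ Γ (P (α ++ n ∷ β)) ⊞ ones (c + j)
  shape = Γ-P-++-tail n α β c j (s≤s z≤n) α<n β<n
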